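{- (a) There is no first-order sentence with $3$ quantifiers and $2$ variables that is separating for $(\{\mathsf{LO}(4)\},\{\mathsf{LO}(3)\})$. (b) Spoiler has a winning strategy in the $3$-round, $2$-color hereditary MS game with repebbling on $(\{\mathsf{LO}(4)\},\{\mathsf{LO}(3)\})$.
   Context: Schema: a single binary relation symbol $<$; $\mathsf{LO}(n)$ is the linear order on $n$ elements. A sentence with $2$ variables uses only variables $x_1,x_2$ (which may be re-quantified); "with 3 quantifiers" counts quantifier occurrences; separating means true in $\mathsf{LO}(4)$ and false in $\mathsf{LO}(3)$. The $r$-round, $k$-color hereditary MS game with repebbling on $(\mathcal{A},\mathcal{B})$: there are $k$ pebble colors; pebbled structures carry at most one pebble of each color. In each round Spoiler chooses a side and a color; if that color has been used before, the pebbles of that color are removed from all structures; Spoiler places a pebble of that color on an element of each pebbled structure on his side; Duplicator, for each pebbled structure on the other side, may make any number of copies and places a pebble of the same color on an element of each copy. The structure resulting from such a move on a pebbled structure $S$ has $S$ as its parent. Two pebbled structures form a matching pair if the map sending the element carrying each color on the left to the element carrying the same color on the right is an isomorphism between the induced substructures. A left pebbled structure $S$ and a right pebbled structure $S'$ in the configuration at the end of round $t'$ form a hereditary match if, letting $S_0,\dots,S_{t'}=S$ and $S'_0,\dots,S'_{t'}=S'$ be their ancestor chains (each $S_i$ the parent of $S_{i+1}$, $S_0,S'_0$ the original unpebbled structures), $S_i$ and $S'_i$ form a matching pair for every $0\le i\le t'$. Spoiler wins if within $r$ rounds a configuration arises with no hereditary match between a left and a right pebbled structure; Duplicator wins if at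 the end of each of the $r$ rounds there is a hereditary match. -}

module Defs where

open import Data.Nat using (ℕ; zero; suc)
open import Data.Fin using (Fin; _<_; _≟_)
open import Data.Bool using (Bool; true; false; _∨_)
open import Data.Maybe using (Maybe; just; nothing; Is-just)
open import Data.List using (List; []; _∷_; map; _++_)
open import Data.List.Relation.Unary.All using (All; []; _∷_)
open import Data.List.Relation.Unary.Any using (Any)
open import Data.List.Relation.Binary.Pointwise using (Pointwise)
open import Data.Product using (Σ; _×_)
open import Data.Sum using (_⊎_)
open import Relation.Nullary using (¬_; yes; no)
open import Relation.Binary.PropositionalEquality using (_≡_)
open import Function.Bundles using (_⇔_)

data Var : Set where
  x₁ x₂ : Var

_≟V_ : Var → Var → Bool
x₁ ≟V x₁ = true
x₂ ≟V x₂ = true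
_  ≟V _  = false

data Formula : Set where
  _≐_  : Var → Var → Formula
  _≺_  : Var → Var → Formula
  ¬'_  : Formula → Formula
  _∧'_ : Formula → Formula → Formula
  _∨'_ : Formula → Formula → Formula
  _⇒'_ : Formula → Formula → Formula
  ∃'   : Var → Formula → Formula
  ∀'   : Var → Formula → Formula

qcount : Formula → ℕ
qcount (x ≐ y)   = 0
qcount (x ≺ y)   = 0
qcount (¬' φ)    = qcount φ
qcount (φ ∧' ψ)  = qcount φ Data.Nat.+ qcount ψ
qcount (φ ∨' ψ)  = qcount φ Data.Nat.+ qcount ψ
qcount (φ ⇒' ψ)  = qcount φ Data.Nat.+ qcount ψ
qcount (∃' x φ)  = suc (qcount φ)
qcount (∀' x φ)  = suc (qcount φ)

free : Formula → Var → Bool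
free (x ≐ y)  v = (x ≟V v) ∨ (y ≟V v)
free (x ≺ y)  v = (x ≟V v) ∨ (y ≟V v)
free (¬' φ)   v = free φ v
free (φ ∧' ψ) v = free φ v ∨ free ψ v
free (φ ∨' ψ) v = free φ v ∨ free ψ v
free (φ ⇒' ψ) v = free φ v ∨ free ψ v
free (∃' x φ) v with x ≟V v
... | true  = false
... | false = free φ v
free (∀' x φ) v with x ≟V v
... | true  = false
... | false = free φ v

IsSentence : Formula → Set
IsSentence φ = (free φ x₁ ≡ false) × (free φ x₂ ≡ false)

-- LO(n): the linear order on n elements, realised as (Fin n, <).
Assignment : ℕ → Set
Assignment n = Var → Fin n

_[_↦_] : ∀ {n} → Assignment n → Var → Fin n → Assignment n
(a [ x ↦ e ]) v with x ≟V v
... | true  = e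
... | false = a v

Sat : (n : ℕ) → Formula → Assignment n → Set
Sat n (x ≐ y)  a = a x ≡ a y
Sat n (x ≺ y)  a = a x < a y
Sat n (¬' φ)   a = ¬ Sat n φ a
Sat n (φ ∧' ψ) a = Sat n φ a × Sat n ψ a
Sat n (φ ∨' ψ) a = Sat n φ a ⊎ Sat n ψ a
Sat n (φ ⇒' ψ) a = Sat n φ a → Sat n ψ a
Sat n (∃' x φ) a = Σ (Fin n) λ e → Sat n φ (a [ x ↦ e ])
Sat n (∀' x φ) a = (e : Fin n) → Sat n φ (a [ x ↦ e ])

-- truth of a sentence in LO(n) (for a sentence, independent of the assignment)
TrueIn : ℕ → Formula → Set
TrueIn n φ = (a : Assignment n) → Sat n φ a

Separating-LO4-LO3 : Formula → Set
Separating-LO4-LO3 φ = TrueIn 4 φ × ¬ TrueIn 3 φ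

Pebbling : ℕ → ℕ → Set
Pebbling k n = Fin k → Maybe (Fin n)

-- A pebbled structure together with its ancestor chain, newest first:
-- S_t ∷ S_{t-1} ∷ … ∷ S_0, with S_0 the unpebbled structure.
History : ℕ → ℕ → Set
History k n = List (Pebbling k n)

unpebbled : ∀ {k n} → Pebbling k n
unpebbled _ = nothing

start : ∀ {k n} → History k n
start = unpebbled ∷ []

repebble : ∀ {k n} → Fin k → Fin n → Pebbling k n → Pebbling k n
repebble c e p d with c ≟ d
... | yes _ = just e
... | no  _ = p d

move : ∀ {k n} → Fin k → Fin n → History k n → History k n
move c e []      = []
move c e (p ∷ h) = repebble c e p ∷ p ∷ h

spoilerStep : ∀ {k n} → Fin k → (Hs : List (History k n)) →
              All (λ _ → Fin n) Hs → List (History k n)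
spoilerStep c []       []       = []
spoilerStep c (h ∷ Hs) (e ∷ es) = move c e h ∷ spoilerStep c Hs es

-- Duplicator's answer on the other side: for each pebbled structure, any
-- number of copies, each copy receiving the pebble on some element
dupStep : ∀ {k n} → Fin k → (Hs : List (History k n)) →
          All (λ _ → List (Fin n)) Hs → List (History k n)
dupStep c []       []         = []
dupStep c (h ∷ Hs) (es ∷ ess) = map (λ e → move c e h) es ++ dupStep c Hs ess

-- matching pair: the map sending the element with colour c on the left to
-- the element with colour c on the right is an isomorphism of the induced
-- substructures (well defined, injective, <-preserving and reflecting)
MatchingPair : ∀ {k n m} → Pebbling k n → Pebbling k m → Set
MatchingPair {k} {n} {m} p q =
  ((c : Fin k) → Is-just (p c) ⇔ Is-just (q c)) ×
  ((c d : Fin k) (a b : Fin n) (a' b' : Fin m) →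
     p c ≡ just a → p d ≡ just b → q c ≡ just a' → q d ≡ just b' →
     (a ≡ b ⇔ a' ≡ b') × (a < b ⇔ a' < b'))

HereditaryMatch : ∀ {k n m} → History k n → History k m → Set
HereditaryMatch = Pointwise MatchingPair

HasHereditaryMatch : ∀ {k n m} → List (History k n) → List (History k m) → Set
HasHereditaryMatch Ls Rs = Any (λ L → Any (λ R → HereditaryMatch L R) Rs) Ls

SpoilerWins : (r k : ℕ) {n m : ℕ} → List (History k n) → List (History k m) → Set
SpoilerWins zero    k Ls Rs = ¬ HasHereditaryMatch Ls Rs
SpoilerWins (suc r) k {n} {m} Ls Rs =
  ¬ HasHereditaryMatch Ls Rs ⊎
  Σ (Fin k) λ c →
    (Σ (All (λ _ → Fin n) Ls) λ es →
       (ds : All (λ _ → List (Fin m)) Rs) →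
       SpoilerWins r k (spoilerStep c Ls es) (dupStep c Rs ds))
    ⊎
    (Σ (All (λ _ → Fin m) Rs) λ es →
       (ds : All (λ _ → List (Fin n)) Ls) →
       SpoilerWins r k (dupStep c Ls ds) (spoilerStep c Rs es))

SpoilerHasWinningStrategy : (r k n m : ℕ) → Set
SpoilerHasWinningStrategy r k n m =
  SpoilerWins r k {n} {m} (start ∷ []) (start ∷ [])

module Submission where

-- (a) Evaluating a formula at all pairs of elements of LO(4) and of LO(3)
-- gives a pair of truth tables, and the tables of ¬ φ, φ ∨ ψ, ∃x φ, ∀x φ are
-- computed from those of φ and ψ (∧ and ⇒ reduce to ¬ and ∨). For each
-- number k ≤ 3 of quantifiers and each pattern of free variables, an explicit
-- finite family of pairs of tables contains the atoms and is mapped into the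
-- right family by every constructor; this is checked by evaluation. The only
-- pairs in the families of sentences are the two constant ones, so a sentence
-- with at most three quantifiers is true in LO(4) iff it is true in LO(3).
--
-- (b) Spoiler pebbles the middle of LO(3). Every element a of LO(4) has two
-- further elements on one side, and Spoiler walks two steps from a to that
-- side with the second colour and then the first one again. Hereditarily
-- matching copies of LO(3) would have to walk two steps from the middle in
-- the same direction, but the middle is only one step away from either end.

open import Defs
open import Data.Bool using (Bool; true; false; T; not; _∧_; _∨_; if_then_else_)
open import Data.Bool.Properties using (not-involutive) renaming (_≟_ to _≟ᵇ_)
open import Data.Empty using (⊥)
open import Data.Fin using (Fin; zero; suc; toℕ; fromℕ<; combine; _<?_; #_)
  renaming (_<_ to _<ᶠ_; _≟_ to _≟ᶠ_)
open import Data.Fin.Properties using (any?; all?; toℕ-fromℕ<)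
open import Data.List using (List; []; _∷_)
open import Data.List.Membership.Propositional using (_∈_)
open import Data.List.Relation.Unary.All as All using (All; []; _∷_)
open import Data.List.Relation.Unary.All.Properties using (All¬⇒¬Any; ++⁺; map⁺)
open import Data.List.Relation.Unary.Any using (here; there)
open import Data.List.Relation.Binary.Pointwise using (_∷_)
open import Data.Maybe using (Maybe; just; nothing; maybe)
open import Data.Nat using (ℕ; zero; suc; _+_; _*_; _≤_; _<_; _≡ᵇ_; s≤s; z<s; s<s; _≤?_)
open import Data.Nat.DivMod using (_/_; _%_)
open import Data.Nat.Properties using (≤-refl; ≤-trans; n≤1+n; m+n≤o⇒m≤o; m+n≤o⇒n≤o; ≰⇒>)
open import Data.Product using (Σ; ∃; _×_; _,_; proj₁; proj₂)
import Data.Product as Product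
import Data.Product.Properties as Product
open import Data.Sum using (inj₁; inj₂)
import Data.Sum as Sum
open import Data.Unit using (⊤; tt)
open import Data.Vec using (Vec; []; _∷_; lookup; tabulate; replicate; reverse)
import Data.Vec.Properties as Vec
open import Function using (_∘_; id)
open import Function.Bundles using (_⇔_; mk⇔; Equivalence)
open import Relation.Binary.PropositionalEquality
  using (_≡_; _≗_; refl; sym; trans; cong; cong₂; subst; subst₂; module ≡-Reasoning)
open import Relation.Nullary using (¬_; Dec; yes; no; does)
open import Relation.Nullary.Decidable
  using (From-yes; from-yes; _×-dec_; _⊎-dec_; _→-dec_; ¬?; map′; dec-true; does-⇔; T?)

open Equivalence using (to; from)

⟨_,_⟩ : ∀ {n} → Fin n → Fin n → Assignment n
⟨ i , j ⟩ x₁ = i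
⟨ i , j ⟩ x₂ = j

assignment-η : ∀ {n} (a : Assignment n) → a ≗ ⟨ a x₁ , a x₂ ⟩
assignment-η a x₁ = refl
assignment-η a x₂ = refl

↦-cong : ∀ {n} {a b : Assignment n} → a ≗ b → ∀ x e → a [ x ↦ e ] ≗ b [ x ↦ e ]
↦-cong a≗b x e v with x ≟V v
... | true  = refl
... | false = a≗b v

Sat-resp-≗ : ∀ n φ {a b : Assignment n} → a ≗ b → Sat n φ a → Sat n φ b
Sat-resp-≗ n (x ≐ y)  a≗b s       = trans (sym (a≗b x)) (trans s (a≗b y))
Sat-resp-≗ n (x ≺ y)  a≗b s       = subst₂ _<ᶠ_ (a≗b x) (a≗b y) s
Sat-resp-≗ n (¬' φ)   a≗b s       = s ∘ Sat-resp-≗ n φ (sym ∘ a≗b)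
Sat-resp-≗ n (φ ∧' ψ) a≗b         = Product.map (Sat-resp-≗ n φ a≗b) (Sat-resp-≗ n ψ a≗b)
Sat-resp-≗ n (φ ∨' ψ) a≗b         = Sum.map (Sat-resp-≗ n φ a≗b) (Sat-resp-≗ n ψ a≗b)
Sat-resp-≗ n (φ ⇒' ψ) a≗b f       = Sat-resp-≗ n ψ a≗b ∘ f ∘ Sat-resp-≗ n φ (sym ∘ a≗b)
Sat-resp-≗ n (∃' x φ) a≗b (e , s) = e , Sat-resp-≗ n φ (↦-cong a≗b x e) s
Sat-resp-≗ n (∀' x φ) a≗b f e     = Sat-resp-≗ n φ (↦-cong a≗b x e) (f e)

Sat-cong : ∀ n φ {a b : Assignment n} → a ≗ b → Sat n φ a ⇔ Sat n φ b
Sat-cong n φ a≗b = mk⇔ (Sat-resp-≗ n φ a≗b) (Sat-resp-≗ n φ (sym ∘ a≗b))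

sat? : ∀ n φ (a : Assignment n) → Dec (Sat n φ a)
sat? n (x ≐ y)  a = a x ≟ᶠ a y
sat? n (x ≺ y)  a = a x <? a y
sat? n (¬' φ)   a = ¬? (sat? n φ a)
sat? n (φ ∧' ψ) a = sat? n φ a ×-dec sat? n ψ a
sat? n (φ ∨' ψ) a = sat? n φ a ⊎-dec sat? n ψ a
sat? n (φ ⇒' ψ) a = sat? n φ a →-dec sat? n ψ a
sat? n (∃' x φ) a = any? λ e → sat? n φ (a [ x ↦ e ])
sat? n (∀' x φ) a = all? λ e → sat? n φ (a [ x ↦ e ])

T-does : ∀ {P : Set} (P? : Dec P) → T (does P?) ⇔ P
T-does (yes p) = mk⇔ (λ _ → p) (λ _ → tt)
T-does (no ¬p) = mk⇔ (λ ()) ¬p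

-- Truth tables on LO(n)

Table : ℕ → Set
Table n = Vec (Vec Bool n) n

entry : ∀ {n} → Table n → Assignment n → Bool
entry t a = lookup (lookup t (a x₁)) (a x₂)

tabulateᵀ : ∀ {n} → (Assignment n → Bool) → Table n
tabulateᵀ f = tabulate λ i → tabulate λ j → f ⟨ i , j ⟩

tabulateᵀ-cong : ∀ {n} (f g : Assignment n → Bool) →
                 (∀ i j → f ⟨ i , j ⟩ ≡ g ⟨ i , j ⟩) → tabulateᵀ f ≡ tabulateᵀ g
tabulateᵀ-cong f g f≗g = Vec.tabulate-cong λ i → Vec.tabulate-cong (f≗g i)

entry-tabulateᵀ : ∀ {n} (f : Assignment n → Bool) a → entry (tabulateᵀ f) a ≡ f ⟨ a x₁ , a x₂ ⟩
entry-tabulateᵀ f a = begin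
  lookup (lookup (tabulateᵀ f) (a x₁)) (a x₂)
    ≡⟨ cong (λ r → lookup r (a x₂)) (Vec.lookup∘tabulate _ (a x₁)) ⟩
  lookup (tabulate λ j → f ⟨ a x₁ , j ⟩) (a x₂)
    ≡⟨ Vec.lookup∘tabulate _ (a x₂) ⟩
  f ⟨ a x₁ , a x₂ ⟩
    ∎
  where open ≡-Reasoning

entry-replicate : ∀ {n} (b : Bool) a → entry (replicate n (replicate n b)) a ≡ b
entry-replicate {n} b a =
  trans (cong (λ r → lookup r (a x₂)) (Vec.lookup-replicate (a x₁) (replicate n b)))
        (Vec.lookup-replicate (a x₂) b)

mapᵀ : ∀ {n} → (Bool → Bool) → Table n → Table n
mapᵀ f t = tabulateᵀ λ a → f (entry t a)

zipWithᵀ : ∀ {n} → (Bool → Bool → Bool) → Table n → Table n → Table n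
zipWithᵀ f t u = tabulateᵀ λ a → f (entry t a) (entry u a)

∃ᵇ ∀ᵇ : ∀ {n} → (Fin n → Bool) → Bool
∃ᵇ f = does (any? (T? ∘ f))
∀ᵇ f = does (all? (T? ∘ f))

quantifyᵀ : ∀ {n} → ((Fin n → Bool) → Bool) → Var → Table n → Table n
quantifyᵀ Q x t = tabulateᵀ λ a → Q λ e → entry t (a [ x ↦ e ])

tableOf : ∀ n → Formula → Table n
tableOf n φ = tabulateᵀ λ a → does (sat? n φ a)

entry-tableOf : ∀ n φ a → entry (tableOf n φ) a ≡ does (sat? n φ a)
entry-tableOf n φ a = trans (entry-tabulateᵀ (λ a → does (sat? n φ a)) a)
  (does-⇔ (Sat-cong n φ (sym ∘ assignment-η a)) (sat? n φ _) (sat? n φ a))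

T-entry-tableOf : ∀ n φ a → T (entry (tableOf n φ) a) ⇔ Sat n φ a
T-entry-tableOf n φ a rewrite entry-tableOf n φ a = T-does (sat? n φ a)

tableOf-≗ : ∀ n φ (g : Assignment n → Bool) →
            (∀ i j → does (sat? n φ ⟨ i , j ⟩) ≡ g ⟨ i , j ⟩) → tableOf n φ ≡ tabulateᵀ g
tableOf-≗ n φ g = tabulateᵀ-cong (λ a → does (sat? n φ a)) g

tableOf-¬ : ∀ n φ → tableOf n (¬' φ) ≡ mapᵀ not (tableOf n φ)
tableOf-¬ n φ = tableOf-≗ n (¬' φ) (not ∘ entry (tableOf n φ)) λ i j →
  cong not (sym (entry-tableOf n φ ⟨ i , j ⟩))

tableOf-zipWith : ∀ n f χ φ ψ →
  (∀ a → does (sat? n χ a) ≡ f (does (sat? n φ a)) (does (sat? n ψ a))) →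
  tableOf n χ ≡ zipWithᵀ f (tableOf n φ) (tableOf n ψ)
tableOf-zipWith n f χ φ ψ χ≡ =
  tableOf-≗ n χ (λ a → f (entry (tableOf n φ) a) (entry (tableOf n ψ) a)) λ i j →
    trans (χ≡ _) (sym (cong₂ f (entry-tableOf n φ ⟨ i , j ⟩) (entry-tableOf n ψ ⟨ i , j ⟩)))

tableOf-∃ : ∀ n x φ → tableOf n (∃' x φ) ≡ quantifyᵀ ∃ᵇ x (tableOf n φ)
tableOf-∃ n x φ = tableOf-≗ n (∃' x φ) (λ a → ∃ᵇ λ e → entry (tableOf n φ) (a [ x ↦ e ])) λ i j →
  does-⇔ (mk⇔ (λ (e , s) → e , from (T-entry-tableOf n φ _) s)
              (λ (e , s) → e , to (T-entry-tableOf n φ _) s))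
         (sat? n (∃' x φ) _) (any? _)

tableOf-∀ : ∀ n x φ → tableOf n (∀' x φ) ≡ quantifyᵀ ∀ᵇ x (tableOf n φ)
tableOf-∀ n x φ = tableOf-≗ n (∀' x φ) (λ a → ∀ᵇ λ e → entry (tableOf n φ) (a [ x ↦ e ])) λ i j →
  does-⇔ (mk⇔ (λ s e → from (T-entry-tableOf n φ _) (s e))
              (λ s e → to (T-entry-tableOf n φ _) (s e)))
         (sat? n (∀' x φ) _) (all? _)

tableOf-constant : ∀ n φ b → tableOf n φ ≡ replicate n (replicate n b) →
                   ∀ a → does (sat? n φ a) ≡ b
tableOf-constant n φ b φ≡b a = begin
  does (sat? n φ a)                      ≡⟨ sym (entry-tableOf n φ a) ⟩
  entry (tableOf n φ) a                  ≡⟨ cong (λ t → entry t a) φ≡b ⟩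
  entry (replicate n (replicate n b)) a  ≡⟨ entry-replicate b a ⟩
  b                                      ∎
  where open ≡-Reasoning

-- Families of pairs of tables on LO(4) and LO(3)

Tables : Set
Tables = Table 4 × Table 3

tables : Formula → Tables
tables φ = tableOf 4 φ , tableOf 3 φ

lift₁ : (∀ {n} → Table n → Table n) → Tables → Tables
lift₁ f (t , u) = f t , f u

lift₂ : (∀ {n} → Table n → Table n → Table n) → Tables → Tables → Tables
lift₂ f (t , u) (t' , u') = f t t' , f u u'

constantTables : Bool → Tables
constantTables b = replicate 4 (replicate 4 b) , replicate 3 (replicate 3 b)

_≟ᵀ_ : (t u : Tables) → Dec (t ≡ u)
_≟ᵀ_ = Product.≡-dec (Vec.≡-dec (Vec.≡-dec _≟ᵇ_)) (Vec.≡-dec (Vec.≡-dec _≟ᵇ_))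

open import Data.List.Membership.DecPropositional _≟ᵀ_ using (_∈?_)

-- nothing stands for the family of all pairs of tables.
Family : Set
Family = Maybe (List Tables)

_∈ᶠ_ : Tables → Family → Set
t ∈ᶠ nothing = ⊤
t ∈ᶠ just F  = t ∈ F

_∈ᶠ?_ : ∀ t F → Dec (t ∈ᶠ F)
t ∈ᶠ? nothing = yes tt
t ∈ᶠ? just F  = t ∈? F

Into₁ : (Tables → Tables) → Family → Family → Set
Into₁ f F        nothing  = ⊤
Into₁ f (just F) (just G) = All (λ t → f t ∈ G) F
Into₁ f nothing  (just G) = ⊥

into₁? : ∀ f F G → Dec (Into₁ f F G)
into₁? f F        nothing  = yes tt
into₁? f (just F) (just G) = All.all? (λ t → f t ∈? G) F
into₁? f nothing  (just G) = no id

into₁-sound : ∀ {f F G t} → Into₁ f F G → t ∈ᶠ F → f t ∈ᶠ G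
into₁-sound {F = F}      {nothing} _ _   = tt
into₁-sound {F = just F} {just G}  h t∈F = All.lookup h t∈F

Into₂ : (Tables → Tables → Tables) → Family → Family → Family → Set
Into₂ f F        G        nothing  = ⊤
Into₂ f (just F) (just G) (just H) = All (λ t → All (λ u → f t u ∈ H) G) F
Into₂ f _        _        (just H) = ⊥

into₂? : ∀ f F G H → Dec (Into₂ f F G H)
into₂? f F        G        nothing  = yes tt
into₂? f (just F) (just G) (just H) = All.all? (λ t → All.all? (λ u → f t u ∈? H) G) F
into₂? f nothing  G        (just H) = no id
into₂? f (just F) nothing  (just H) = no id

into₂-sound : ∀ {f F G H t u} → Into₂ f F G H → t ∈ᶠ F → u ∈ᶠ G → f t u ∈ᶠ H
into₂-sound {H = nothing} _ _ _ = tt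
into₂-sound {F = just F} {just G} {just H} h t∈F u∈G = All.lookup (All.lookup h t∈F) u∈G

-- A table is written as a binary literal listing its rows, first row first.
bits : ∀ len → ℕ → Vec Bool len
bits len k = reverse (lowBitsFirst len k)
  where
  lowBitsFirst : ∀ len → ℕ → Vec Bool len
  lowBitsFirst zero      k = []
  lowBitsFirst (suc len) k = (k % 2 ≡ᵇ 1) ∷ lowBitsFirst len (k / 2)

matrix : ∀ n → ℕ → Table n
matrix n k = tabulate λ i → tabulate λ j → lookup (bits (n * n) k) (combine i j)

⟪_,_⟫ : ℕ → ℕ → Tables
⟪ k , l ⟫ = matrix 4 k , matrix 3 l

-- The tables of the formulas with k quantifiers in which x₁ is free iff b₁
-- and x₂ is free iff b₂, found by enumerating formulas; no constraint is
-- needed for the families left unlisted.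
family : ℕ → Bool → Bool → Family
family 0 false false = just []
family 0 false true = just
  ( ⟪ 0b1111_1111_1111_1111 , 0b111_111_111 ⟫ ∷ ⟪ 0b0000_0000_0000_0000 , 0b000_000_000 ⟫
  ∷ [])
family 0 true false = just
  ( ⟪ 0b1111_1111_1111_1111 , 0b111_111_111 ⟫ ∷ ⟪ 0b0000_0000_0000_0000 , 0b000_000_000 ⟫
  ∷ [])
family 0 true true = just
  ( ⟪ 0b1111_1111_1111_1111 , 0b111_111_111 ⟫ ∷ ⟪ 0b1111_0111_0011_0001 , 0b111_011_001 ⟫
  ∷ ⟪ 0b1000_1100_1110_1111 , 0b100_110_111 ⟫ ∷ ⟪ 0b1000_0100_0010_0001 , 0b100_010_001 ⟫
  ∷ ⟪ 0b0111_1011_1101_1110 , 0b011_101_110 ⟫ ∷ ⟪ 0b0111_0011_0001_0000 , 0b011_001_000 ⟫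
  ∷ ⟪ 0b0000_1000_1100_1110 , 0b000_100_110 ⟫ ∷ ⟪ 0b0000_0000_0000_0000 , 0b000_000_000 ⟫
  ∷ [])
family 1 false false = just
  ( ⟪ 0b1111_1111_1111_1111 , 0b111_111_111 ⟫ ∷ ⟪ 0b0000_0000_0000_0000 , 0b000_000_000 ⟫
  ∷ [])
family 1 false true = just
  ( ⟪ 0b1111_1111_1111_1111 , 0b111_111_111 ⟫ ∷ ⟪ 0b1110_1110_1110_1110 , 0b110_110_110 ⟫
  ∷ ⟪ 0b1000_1000_1000_1000 , 0b100_100_100 ⟫ ∷ ⟪ 0b0111_0111_0111_0111 , 0b011_011_011 ⟫
  ∷ ⟪ 0b0001_0001_0001_0001 , 0b001_001_001 ⟫ ∷ ⟪ 0b0000_0000_0000_0000 , 0b000_000_000 ⟫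
  ∷ [])
family 1 true false = just
  ( ⟪ 0b1111_1111_1111_1111 , 0b111_111_111 ⟫ ∷ ⟪ 0b1111_1111_1111_0000 , 0b111_111_000 ⟫
  ∷ ⟪ 0b1111_0000_0000_0000 , 0b111_000_000 ⟫ ∷ ⟪ 0b0000_1111_1111_1111 , 0b000_111_111 ⟫
  ∷ ⟪ 0b0000_0000_0000_1111 , 0b000_000_111 ⟫ ∷ ⟪ 0b0000_0000_0000_0000 , 0b000_000_000 ⟫
  ∷ [])
family 1 true true = just
  ( ⟪ 0b1111_1111_1111_1111 , 0b111_111_111 ⟫ ∷ ⟪ 0b1111_1111_1111_1110 , 0b111_111_110 ⟫
  ∷ ⟪ 0b1111_1111_1111_0001 , 0b111_111_001 ⟫ ∷ ⟪ 0b1111_1111_1111_0000 , 0b111_111_000 ⟫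
  ∷ ⟪ 0b1111_1111_1011_1001 , 0b111_111_101 ⟫ ∷ ⟪ 0b1111_1100_1110_1111 , 0b111_110_111 ⟫
  ∷ ⟪ 0b1111_1011_1101_1110 , 0b111_101_110 ⟫ ∷ ⟪ 0b1111_1011_1001_1000 , 0b111_101_100 ⟫
  ∷ ⟪ 0b1111_1000_1100_1110 , 0b111_100_110 ⟫ ∷ ⟪ 0b1111_0111_0111_0111 , 0b111_011_011 ⟫
  ∷ ⟪ 0b1111_0111_0011_1111 , 0b111_011_111 ⟫ ∷ ⟪ 0b1111_0111_0011_0001 , 0b111_011_001 ⟫
  ∷ ⟪ 0b1111_0111_0011_0000 , 0b111_011_000 ⟫ ∷ ⟪ 0b1111_0100_0010_0001 , 0b111_010_001 ⟫
  ∷ ⟪ 0b1111_0011_0001_0000 , 0b111_001_000 ⟫ ∷ ⟪ 0b1111_0000_0000_0000 , 0b111_000_000 ⟫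
  ∷ ⟪ 0b1110_1110_1110_1111 , 0b110_110_111 ⟫ ∷ ⟪ 0b1110_1110_1110_1110 , 0b110_110_110 ⟫
  ∷ ⟪ 0b1110_0110_0010_0001 , 0b110_010_001 ⟫ ∷ ⟪ 0b1110_0110_0010_0000 , 0b110_010_000 ⟫
  ∷ ⟪ 0b1001_1101_1111_1111 , 0b101_111_111 ⟫ ∷ ⟪ 0b1001_0101_0011_0001 , 0b101_011_001 ⟫
  ∷ ⟪ 0b1000_1111_1111_1111 , 0b100_111_111 ⟫ ∷ ⟪ 0b1000_1100_1110_1111 , 0b100_110_111 ⟫
  ∷ ⟪ 0b1000_1100_1110_1110 , 0b100_110_110 ⟫ ∷ ⟪ 0b1000_1100_1110_0001 , 0b100_110_001 ⟫
  ∷ ⟪ 0b1000_1100_1110_0000 , 0b100_110_000 ⟫ ∷ ⟪ 0b1000_1100_1010_1001 , 0b100_110_101 ⟫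
  ∷ ⟪ 0b1000_1000_1100_1110 , 0b100_100_110 ⟫ ∷ ⟪ 0b1000_1000_1000_1000 , 0b100_100_100 ⟫
  ∷ ⟪ 0b1000_0111_0011_0001 , 0b100_011_001 ⟫ ∷ ⟪ 0b1000_0100_0110_0111 , 0b100_010_011 ⟫
  ∷ ⟪ 0b1000_0100_0010_1111 , 0b100_010_111 ⟫ ∷ ⟪ 0b1000_0100_0010_0001 , 0b100_010_001 ⟫
  ∷ ⟪ 0b1000_0100_0010_0000 , 0b100_010_000 ⟫ ∷ ⟪ 0b1000_0000_0000_0000 , 0b100_000_000 ⟫
  ∷ ⟪ 0b0111_1111_1111_1111 , 0b011_111_111 ⟫ ∷ ⟪ 0b0111_1011_1101_1111 , 0b011_101_111 ⟫
  ∷ ⟪ 0b0111_1011_1101_1110 , 0b011_101_110 ⟫ ∷ ⟪ 0b0111_1011_1101_0000 , 0b011_101_000 ⟫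
  ∷ ⟪ 0b0111_1011_1001_1000 , 0b011_101_100 ⟫ ∷ ⟪ 0b0111_1000_1100_1110 , 0b011_100_110 ⟫
  ∷ ⟪ 0b0111_0111_0111_0111 , 0b011_011_011 ⟫ ∷ ⟪ 0b0111_0111_0011_0001 , 0b011_011_001 ⟫
  ∷ ⟪ 0b0111_0011_0101_0110 , 0b011_001_010 ⟫ ∷ ⟪ 0b0111_0011_0001_1111 , 0b011_001_111 ⟫
  ∷ ⟪ 0b0111_0011_0001_1110 , 0b011_001_110 ⟫ ∷ ⟪ 0b0111_0011_0001_0001 , 0b011_001_001 ⟫
  ∷ ⟪ 0b0111_0011_0001_0000 , 0b011_001_000 ⟫ ∷ ⟪ 0b0111_0000_0000_0000 , 0b011_000_000 ⟫
  ∷ ⟪ 0b0110_1010_1100_1110 , 0b010_100_110 ⟫ ∷ ⟪ 0b0110_0010_0000_0000 , 0b010_000_000 ⟫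
  ∷ ⟪ 0b0001_1001_1101_1111 , 0b001_101_111 ⟫ ∷ ⟪ 0b0001_1001_1101_1110 , 0b001_101_110 ⟫
  ∷ ⟪ 0b0001_0001_0001_0001 , 0b001_001_001 ⟫ ∷ ⟪ 0b0001_0001_0001_0000 , 0b001_001_000 ⟫
  ∷ ⟪ 0b0000_1111_1111_1111 , 0b000_111_111 ⟫ ∷ ⟪ 0b0000_1100_1110_1111 , 0b000_110_111 ⟫
  ∷ ⟪ 0b0000_1011_1101_1110 , 0b000_101_110 ⟫ ∷ ⟪ 0b0000_1000_1100_1111 , 0b000_100_111 ⟫
  ∷ ⟪ 0b0000_1000_1100_1110 , 0b000_100_110 ⟫ ∷ ⟪ 0b0000_1000_1100_0000 , 0b000_100_000 ⟫
  ∷ ⟪ 0b0000_1000_1000_1000 , 0b000_100_100 ⟫ ∷ ⟪ 0b0000_0111_0011_0001 , 0b000_011_001 ⟫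
  ∷ ⟪ 0b0000_0100_0110_0111 , 0b000_010_011 ⟫ ∷ ⟪ 0b0000_0100_0010_0001 , 0b000_010_001 ⟫
  ∷ ⟪ 0b0000_0011_0001_0000 , 0b000_001_000 ⟫ ∷ ⟪ 0b0000_0000_0100_0110 , 0b000_000_010 ⟫
  ∷ ⟪ 0b0000_0000_0000_1111 , 0b000_000_111 ⟫ ∷ ⟪ 0b0000_0000_0000_1110 , 0b000_000_110 ⟫
  ∷ ⟪ 0b0000_0000_0000_0001 , 0b000_000_001 ⟫ ∷ ⟪ 0b0000_0000_0000_0000 , 0b000_000_000 ⟫
  ∷ [])
family 2 false false = just
  ( ⟪ 0b1111_1111_1111_1111 , 0b111_111_111 ⟫ ∷ ⟪ 0b0000_0000_0000_0000 , 0b000_000_000 ⟫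
  ∷ [])
family 2 false true = just
  ( ⟪ 0b1111_1111_1111_1111 , 0b111_111_111 ⟫ ∷ ⟪ 0b1110_1110_1110_1110 , 0b110_110_110 ⟫
  ∷ ⟪ 0b1100_1100_1100_1100 , 0b110_110_110 ⟫ ∷ ⟪ 0b1100_1100_1100_1100 , 0b100_100_100 ⟫
  ∷ ⟪ 0b1001_1001_1001_1001 , 0b101_101_101 ⟫ ∷ ⟪ 0b1000_1000_1000_1000 , 0b100_100_100 ⟫
  ∷ ⟪ 0b0111_0111_0111_0111 , 0b011_011_011 ⟫ ∷ ⟪ 0b0110_0110_0110_0110 , 0b010_010_010 ⟫
  ∷ ⟪ 0b0011_0011_0011_0011 , 0b011_011_011 ⟫ ∷ ⟪ 0b0011_0011_0011_0011 , 0b001_001_001 ⟫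
  ∷ ⟪ 0b0001_0001_0001_0001 , 0b001_001_001 ⟫ ∷ ⟪ 0b0000_0000_0000_0000 , 0b000_000_000 ⟫
  ∷ [])
family 2 true false = just
  ( ⟪ 0b1111_1111_1111_1111 , 0b111_111_111 ⟫ ∷ ⟪ 0b1111_1111_1111_0000 , 0b111_111_000 ⟫
  ∷ ⟪ 0b1111_1111_0000_0000 , 0b111_111_000 ⟫ ∷ ⟪ 0b1111_1111_0000_0000 , 0b111_000_000 ⟫
  ∷ ⟪ 0b1111_0000_0000_1111 , 0b111_000_111 ⟫ ∷ ⟪ 0b1111_0000_0000_0000 , 0b111_000_000 ⟫
  ∷ ⟪ 0b0000_1111_1111_1111 , 0b000_111_111 ⟫ ∷ ⟪ 0b0000_1111_1111_0000 , 0b000_111_000 ⟫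
  ∷ ⟪ 0b0000_0000_1111_1111 , 0b000_111_111 ⟫ ∷ ⟪ 0b0000_0000_1111_1111 , 0b000_000_111 ⟫
  ∷ ⟪ 0b0000_0000_0000_1111 , 0b000_000_111 ⟫ ∷ ⟪ 0b0000_0000_0000_0000 , 0b000_000_000 ⟫
  ∷ [])
family 3 false false = just
  ( ⟪ 0b1111_1111_1111_1111 , 0b111_111_111 ⟫ ∷ ⟪ 0b0000_0000_0000_0000 , 0b000_000_000 ⟫
  ∷ [])
family _ _ _ = nothing

family-beyond : ∀ k b₁ b₂ → 3 < k → family k b₁ b₂ ≡ nothing
family-beyond (suc (suc (suc (suc k)))) b₁ b₂ _ = refl
family-beyond 0 b₁ b₂ ()
family-beyond 1 b₁ b₂ (s≤s ())
family-beyond 2 b₁ b₂ (s≤s (s≤s ()))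
family-beyond 3 b₁ b₂ (s≤s (s≤s (s≤s ())))

upTo3 : (P : ℕ → Set) → (∀ (k : Fin 4) → P (toℕ k)) → ∀ k → k ≤ 3 → P k
upTo3 P h k k≤3 = subst P (toℕ-fromℕ< (s≤s k≤3)) (h (fromℕ< (s≤s k≤3)))

∀-Bool? : {P : Bool → Set} → (∀ b → Dec (P b)) → Dec (∀ b → P b)
∀-Bool? P? = map′ (λ (f , t) → λ { false → f ; true → t }) (λ h → h false , h true)
                  (P? false ×-dec P? true)

Closed₁ : (Tables → Tables) → (ℕ → ℕ) → (Bool → Bool) → (Bool → Bool) → Set
Closed₁ f s g₁ g₂ = ∀ k b₁ b₂ → Into₁ f (family k b₁ b₂) (family (s k) (g₁ b₁) (g₂ b₂))

ClosedUpTo3₁ : (Tables → Tables) → (ℕ → ℕ) → (Bool → Bool) → (Bool → Bool) → Set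
ClosedUpTo3₁ f s g₁ g₂ = ∀ (k : Fin 4) b₁ b₂ →
  Into₁ f (family (toℕ k) b₁ b₂) (family (s (toℕ k)) (g₁ b₁) (g₂ b₂))

closedUpTo3₁? : ∀ f s g₁ g₂ → Dec (ClosedUpTo3₁ f s g₁ g₂)
closedUpTo3₁? f s g₁ g₂ = all? λ k → ∀-Bool? λ b₁ → ∀-Bool? λ b₂ →
  into₁? f (family (toℕ k) b₁ b₂) (family (s (toℕ k)) (g₁ b₁) (g₂ b₂))

ClosedUpTo3₁⇒Closed₁ : ∀ {f s g₁ g₂} → (∀ k → k ≤ s k) →
                       ClosedUpTo3₁ f s g₁ g₂ → Closed₁ f s g₁ g₂
ClosedUpTo3₁⇒Closed₁ {f} {s} {g₁} {g₂} k≤sk closed k b₁ b₂ with k ≤? 3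
... | yes k≤3 = upTo3 (λ k → Into₁ f (family k b₁ b₂) (family (s k) (g₁ b₁) (g₂ b₂)))
                      (λ i → closed i b₁ b₂) k k≤3
... | no  k≰3 rewrite family-beyond (s k) (g₁ b₁) (g₂ b₂) (≤-trans (≰⇒> k≰3) (k≤sk k)) = tt

Closed₂ : (Tables → Tables → Tables) → Set
Closed₂ f = ∀ k l b₁ b₂ c₁ c₂ →
  Into₂ f (family k b₁ b₂) (family l c₁ c₂) (family (k + l) (b₁ ∨ c₁) (b₂ ∨ c₂))

ClosedUpTo3₂ : (Tables → Tables → Tables) → Set
ClosedUpTo3₂ f = ∀ (k l : Fin 4) b₁ b₂ c₁ c₂ →
  Into₂ f (family (toℕ k) b₁ b₂) (family (toℕ l) c₁ c₂)
          (family (toℕ k + toℕ l) (b₁ ∨ c₁) (b₂ ∨ c₂))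

closedUpTo3₂? : ∀ f → Dec (ClosedUpTo3₂ f)
closedUpTo3₂? f =
  all? λ k → all? λ l → ∀-Bool? λ b₁ → ∀-Bool? λ b₂ → ∀-Bool? λ c₁ → ∀-Bool? λ c₂ →
    into₂? f (family (toℕ k) b₁ b₂) (family (toℕ l) c₁ c₂)
             (family (toℕ k + toℕ l) (b₁ ∨ c₁) (b₂ ∨ c₂))

ClosedUpTo3₂⇒Closed₂ : ∀ {f} → ClosedUpTo3₂ f → Closed₂ f
ClosedUpTo3₂⇒Closed₂ {f} closed k l b₁ b₂ c₁ c₂ with k + l ≤? 3
... | yes k+l≤3 =
  upTo3 (λ k → Into₂ f (family k b₁ b₂) (family l c₁ c₂) (family (k + l) (b₁ ∨ c₁) (b₂ ∨ c₂)))
    (λ i → upTo3 (λ l → Into₂ f (family (toℕ i) b₁ b₂) (family l c₁ c₂)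
                                 (family (toℕ i + l) (b₁ ∨ c₁) (b₂ ∨ c₂)))
                 (λ j → closed i j b₁ b₂ c₁ c₂) l (m+n≤o⇒n≤o k k+l≤3))
    k (m+n≤o⇒m≤o k k+l≤3)
... | no  k+l≰3 rewrite family-beyond (k + l) (b₁ ∨ c₁) (b₂ ∨ c₂) (≰⇒> k+l≰3) = tt

unbind : Var → Var → Bool → Bool
unbind x v b = if x ≟V v then false else b

closed-¬ : Closed₁ (lift₁ (mapᵀ not)) id id id
closed-¬ = ClosedUpTo3₁⇒Closed₁ (λ _ → ≤-refl)
  (from-yes (closedUpTo3₁? (lift₁ (mapᵀ not)) id id id))

closed-∨ : Closed₂ (lift₂ (zipWithᵀ _∨_))
closed-∨ = ClosedUpTo3₂⇒Closed₂ (from-yes (closedUpTo3₂? (lift₂ (zipWithᵀ _∨_))))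

closed-∃ : ∀ x → Closed₁ (lift₁ (quantifyᵀ ∃ᵇ x)) suc (unbind x x₁) (unbind x x₂)
closed-∃ x₁ = ClosedUpTo3₁⇒Closed₁ n≤1+n
  (from-yes (closedUpTo3₁? (lift₁ (quantifyᵀ ∃ᵇ x₁)) suc (unbind x₁ x₁) (unbind x₁ x₂)))
closed-∃ x₂ = ClosedUpTo3₁⇒Closed₁ n≤1+n
  (from-yes (closedUpTo3₁? (lift₁ (quantifyᵀ ∃ᵇ x₂)) suc (unbind x₂ x₁) (unbind x₂ x₂)))

closed-∀ : ∀ x → Closed₁ (lift₁ (quantifyᵀ ∀ᵇ x)) suc (unbind x x₁) (unbind x x₂)
closed-∀ x₁ = ClosedUpTo3₁⇒Closed₁ n≤1+n
  (from-yes (closedUpTo3₁? (lift₁ (quantifyᵀ ∀ᵇ x₁)) suc (unbind x₁ x₁) (unbind x₁ x₂)))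
closed-∀ x₂ = ClosedUpTo3₁⇒Closed₁ n≤1+n
  (from-yes (closedUpTo3₁? (lift₁ (quantifyᵀ ∀ᵇ x₂)) suc (unbind x₂ x₁) (unbind x₂ x₂)))

tables-into₁ : ∀ {F G} χ φ (f : ∀ {n} → Table n → Table n) →
               (∀ n → tableOf n χ ≡ f (tableOf n φ)) →
               Into₁ (lift₁ f) F G → tables φ ∈ᶠ F → tables χ ∈ᶠ G
tables-into₁ {G = G} χ φ f χ≡ closed φ∈F =
  subst (_∈ᶠ G) (sym (cong₂ _,_ (χ≡ 4) (χ≡ 3))) (into₁-sound closed φ∈F)

tables-into₂ : ∀ {F G H} χ φ ψ (f : ∀ {n} → Table n → Table n → Table n) →
               (∀ n → tableOf n χ ≡ f (tableOf n φ) (tableOf n ψ)) →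
               Into₂ (lift₂ f) F G H → tables φ ∈ᶠ F → tables ψ ∈ᶠ G → tables χ ∈ᶠ H
tables-into₂ {H = H} χ φ ψ f χ≡ closed φ∈F ψ∈G =
  subst (_∈ᶠ H) (sym (cong₂ _,_ (χ≡ 4) (χ≡ 3))) (into₂-sound closed φ∈F ψ∈G)

tables-cong : ∀ {F} χ χ' → (∀ n a → does (sat? n χ a) ≡ does (sat? n χ' a)) →
              tables χ ∈ᶠ F → tables χ' ∈ᶠ F
tables-cong {F} χ χ' χ≡χ' = subst (_∈ᶠ F) (cong₂ _,_ (same 4) (same 3))
  where
  same : ∀ n → tableOf n χ ≡ tableOf n χ'
  same n = tabulateᵀ-cong (λ a → does (sat? n χ a)) (λ a → does (sat? n χ' a))
                          λ i j → χ≡χ' n ⟨ i , j ⟩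

not-∨-not : ∀ x y → not (not x ∨ not y) ≡ x ∧ y
not-∨-not true  y = not-involutive y
not-∨-not false y = refl

atom-in-family : ∀ φ → From-yes (tables φ ∈ᶠ? family 0 (free φ x₁) (free φ x₂))
atom-in-family φ = from-yes (tables φ ∈ᶠ? family 0 (free φ x₁) (free φ x₂))

¬-in-family : ∀ φ {k b₁ b₂} → tables φ ∈ᶠ family k b₁ b₂ → tables (¬' φ) ∈ᶠ family k b₁ b₂
¬-in-family φ = tables-into₁ (¬' φ) φ (mapᵀ not) (λ n → tableOf-¬ n φ) (closed-¬ _ _ _)

∨-in-family : ∀ φ ψ {k l b₁ b₂ c₁ c₂} →
              tables φ ∈ᶠ family k b₁ b₂ → tables ψ ∈ᶠ family l c₁ c₂ →
              tables (φ ∨' ψ) ∈ᶠ family (k + l) (b₁ ∨ c₁) (b₂ ∨ c₂)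
∨-in-family φ ψ = tables-into₂ (φ ∨' ψ) φ ψ (zipWithᵀ _∨_)
  (λ n → tableOf-zipWith n _∨_ (φ ∨' ψ) φ ψ λ _ → refl) (closed-∨ _ _ _ _ _ _)

tables-in-family : ∀ φ → tables φ ∈ᶠ family (qcount φ) (free φ x₁) (free φ x₂)
tables-in-family φ@(x₁ ≐ x₁) = atom-in-family φ
tables-in-family φ@(x₁ ≐ x₂) = atom-in-family φ
tables-in-family φ@(x₂ ≐ x₁) = atom-in-family φ
tables-in-family φ@(x₂ ≐ x₂) = atom-in-family φ
tables-in-family φ@(x₁ ≺ x₁) = atom-in-family φ
tables-in-family φ@(x₁ ≺ x₂) = atom-in-family φ
tables-in-family φ@(x₂ ≺ x₁) = atom-in-family φ
tables-in-family φ@(x₂ ≺ x₂) = atom-in-family φ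
tables-in-family (¬' φ)   = ¬-in-family φ (tables-in-family φ)
tables-in-family (φ ∨' ψ) = ∨-in-family φ ψ (tables-in-family φ) (tables-in-family ψ)
tables-in-family (φ ∧' ψ) =
  tables-cong (¬' ((¬' φ) ∨' (¬' ψ))) (φ ∧' ψ)
    (λ n a → not-∨-not (does (sat? n φ a)) (does (sat? n ψ a)))
    (¬-in-family ((¬' φ) ∨' (¬' ψ))
      (∨-in-family (¬' φ) (¬' ψ) (¬-in-family φ (tables-in-family φ))
                                 (¬-in-family ψ (tables-in-family ψ))))
tables-in-family (φ ⇒' ψ) =
  tables-cong ((¬' φ) ∨' ψ) (φ ⇒' ψ) (λ n a → refl)
    (∨-in-family (¬' φ) ψ (¬-in-family φ (tables-in-family φ)) (tables-in-family ψ))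
tables-in-family (∃' x₁ φ) = tables-into₁ (∃' x₁ φ) φ (quantifyᵀ ∃ᵇ x₁)
  (λ n → tableOf-∃ n x₁ φ) (closed-∃ x₁ _ _ _) (tables-in-family φ)
tables-in-family (∃' x₂ φ) = tables-into₁ (∃' x₂ φ) φ (quantifyᵀ ∃ᵇ x₂)
  (λ n → tableOf-∃ n x₂ φ) (closed-∃ x₂ _ _ _) (tables-in-family φ)
tables-in-family (∀' x₁ φ) = tables-into₁ (∀' x₁ φ) φ (quantifyᵀ ∀ᵇ x₁)
  (λ n → tableOf-∀ n x₁ φ) (closed-∀ x₁ _ _ _) (tables-in-family φ)
tables-in-family (∀' x₂ φ) = tables-into₁ (∀' x₂ φ) φ (quantifyᵀ ∀ᵇ x₂)
  (λ n → tableOf-∀ n x₂ φ) (closed-∀ x₂ _ _ _) (tables-in-family φ)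

sentence-tables-constant : ∀ k → k ≤ 3 → ∀ {t} → t ∈ᶠ family k false false →
                           t ∈ constantTables false ∷ constantTables true ∷ []
sentence-tables-constant k k≤3 =
  into₁-sound {f = id} (upTo3 (λ k → Into₁ id (family k false false) constant) check k k≤3)
  where
  constant : Family
  constant = just (constantTables false ∷ constantTables true ∷ [])
  check : ∀ (k : Fin 4) → Into₁ id (family (toℕ k) false false) constant
  check = from-yes (all? λ (k : Fin 4) → into₁? id (family (toℕ k) false false) constant)

no-separating-sentence : ¬ Σ Formula (λ φ → IsSentence φ × qcount φ ≤ 3 × Separating-LO4-LO3 φ)
no-separating-sentence (φ , (x₁-bound , x₂-bound) , q≤3 , true₄ , ¬true₃)
  with sentence-tables-constant (qcount φ) q≤3
         (subst₂ (λ b₁ b₂ → tables φ ∈ᶠ family (qcount φ) b₁ b₂) x₁-bound x₂-bound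
                 (tables-in-family φ))
... | here φ≡false
  with trans (sym (tableOf-constant 4 φ false (cong proj₁ φ≡false) ⟨ zero , zero ⟩))
             (dec-true (sat? 4 φ _) (true₄ _))
...   | ()
no-separating-sentence (φ , _ , _ , _ , ¬true₃) | there (here φ≡true) = ¬true₃ λ a →
  to (T-does (sat? 3 φ a)) (subst T (sym (tableOf-constant 3 φ true (cong proj₂ φ≡true) a)) tt)

-- Spoiler's strategy in the hereditary game

pebbleOf : ∀ {k n} → Fin k → History k n → Maybe (Fin n)
pebbleOf c []      = nothing
pebbleOf c (p ∷ _) = p c

All-spoilerStep : ∀ {k n} {P Q : History k n → Set} c (σ : History k n → Fin n) Hs →
  (∀ h → P h → Q (move c (σ h) h)) → All P Hs → All Q (spoilerStep c Hs (All.universal σ Hs))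
All-spoilerStep c σ []       step []       = []
All-spoilerStep c σ (h ∷ Hs) step (p ∷ ps) = step h p ∷ All-spoilerStep c σ Hs step ps

All-dupStep : ∀ {k n} {P Q : History k n → Set} c Hs (ds : All (λ _ → List (Fin n)) Hs) →
  (∀ h e → P h → Q (move c e h)) → All P Hs → All Q (dupStep c Hs ds)
All-dupStep c []       []         step []       = []
All-dupStep c (h ∷ Hs) (es ∷ ess) step (p ∷ ps) =
  ++⁺ (map⁺ (All.universal (λ e → step h e p) es)) (All-dupStep c Hs ess step ps)

¬HasHereditaryMatch : ∀ {k n m} {P : History k n → Set} {Q : History k m → Set} {Ls Rs} →
  (∀ {L R} → P L → Q R → ¬ HereditaryMatch L R) → All P Ls → All Q Rs →
  ¬ HasHereditaryMatch Ls Rs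
¬HasHereditaryMatch apart pLs qRs =
  All¬⇒¬Any (All.map (λ pL → All¬⇒¬Any (All.map (apart pL) qRs)) pLs)

SameOrder : ∀ {n m} → Fin n → Fin n → Fin m → Fin m → Set
SameOrder a b a' b' = (a <ᶠ b ⇔ a' <ᶠ b') × (b <ᶠ a ⇔ b' <ᶠ a')

MatchingPair⇒SameOrder : ∀ {k n m} {p : Pebbling k n} {q : Pebbling k m} → MatchingPair p q →
  ∀ c d {a b a' b'} → p c ≡ just a → p d ≡ just b → q c ≡ just a' → q d ≡ just b' →
  SameOrder a b a' b'
MatchingPair⇒SameOrder (_ , iso) c d pc pd qc qd =
  proj₂ (iso c d _ _ _ _ pc pd qc qd) , proj₂ (iso d c _ _ _ _ pd pc qd qc)

middle : Fin 3
middle = # 1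

no-two-steps-up : {e e' : Fin 3} → middle <ᶠ e → ¬ e <ᶠ e'
no-two-steps-up {suc (suc zero)} {suc (suc zero)} _ (s≤s (s≤s ()))
no-two-steps-up {suc (suc zero)} {suc zero}       _ (s≤s ())
no-two-steps-up {suc (suc zero)} {zero}           _ ()
no-two-steps-up {suc zero}       (s≤s ())
no-two-steps-up {zero}           ()

no-two-steps-down : {e e' : Fin 3} → e <ᶠ middle → ¬ e' <ᶠ e
no-two-steps-down {zero}  _ ()
no-two-steps-down {suc _} (s≤s ())

-- The first and the second step from a towards an end of LO(4) two steps away.
away₁ away₂ : Fin 4 → Fin 4
away₁ zero                   = # 1
away₁ (suc zero)             = # 2
away₁ (suc (suc zero))       = # 1
away₁ (suc (suc (suc zero))) = # 2
away₂ zero                   = # 2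
away₂ (suc zero)             = # 3
away₂ (suc (suc zero))       = # 0
away₂ (suc (suc (suc zero))) = # 1

two-steps-away : ∀ a {e e'} → SameOrder a (away₁ a) middle e →
                 SameOrder (away₂ a) (away₁ a) e' e → ⊥
two-steps-away zero                   (o₂ , _) (_ , o₃) =
  no-two-steps-up (to o₂ z<s) (to o₃ (s<s z<s))
two-steps-away (suc zero)             (o₂ , _) (_ , o₃) =
  no-two-steps-up (to o₂ (s<s z<s)) (to o₃ (s<s (s<s z<s)))
two-steps-away (suc (suc zero))       (_ , o₂) (o₃ , _) =
  no-two-steps-down (to o₂ (s<s z<s)) (to o₃ z<s)
two-steps-away (suc (suc (suc zero))) (_ , o₂) (o₃ , _) =
  no-two-steps-down (to o₂ (s<s (s<s z<s))) (to o₃ (s<s z<s))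

-- The default element is never used: Spoiler only plays on histories carrying colour 0.
fromPebble₀ : (Fin 4 → Fin 4) → History 2 4 → Fin 4
fromPebble₀ f h = maybe f zero (pebbleOf (# 0) h)

left₁ left₂ left₃ : Fin 4 → History 2 4
left₁ a = move (# 0) a start
left₂ a = move (# 1) (away₁ a) (left₁ a)
left₃ a = move (# 0) (away₂ a) (left₂ a)

right₁ : History 2 3
right₁ = move (# 0) middle start

right₂ : Fin 3 → History 2 3
right₂ e = move (# 1) e right₁

right₃ : Fin 3 → Fin 3 → History 2 3
right₃ e e' = move (# 0) e' (right₂ e)

Left₁ Left₂ Left₃ : History 2 4 → Set
Left₁ h = ∃ λ a → h ≡ left₁ a
Left₂ h = ∃ λ a → h ≡ left₂ a
Left₃ h = ∃ λ a → h ≡ left₃ a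

Right₂ Right₃ : History 2 3 → Set
Right₂ h = ∃ λ e → h ≡ right₂ e
Right₃ h = ∃ λ e → ∃ λ e' → h ≡ right₃ e e'

Left₃≁Right₃ : ∀ {L R} → Left₃ L → Right₃ R → ¬ HereditaryMatch L R
Left₃≁Right₃ (a , refl) (e , e' , refl) (m₃ ∷ m₂ ∷ _) =
  two-steps-away a (MatchingPair⇒SameOrder m₂ (# 0) (# 1) refl refl refl refl)
                   (MatchingPair⇒SameOrder m₃ (# 0) (# 1) refl refl refl refl)

round₃ : ∀ {Ls Rs} → All Left₂ Ls → All Right₂ Rs → SpoilerWins 1 2 Ls Rs
round₃ {Ls} {Rs} pLs pRs = inj₂ (# 0 , inj₁ (All.universal (fromPebble₀ away₂) Ls , λ ds →
  ¬HasHereditaryMatch Left₃≁Right₃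
    (All-spoilerStep {P = Left₂} {Left₃} (# 0) (fromPebble₀ away₂) Ls
                     (λ { _ (a , refl) → a , refl }) pLs)
    (All-dupStep {P = Right₂} {Right₃} (# 0) Rs ds
                 (λ { _ e' (e , refl) → e , e' , refl }) pRs)))

round₂ : ∀ {Ls} → All Left₁ Ls → SpoilerWins 2 2 Ls (right₁ ∷ [])
round₂ {Ls} pLs = inj₂ (# 1 , inj₁ (All.universal (fromPebble₀ away₁) Ls , λ ds →
  round₃ (All-spoilerStep {P = Left₁} {Left₂} (# 1) (fromPebble₀ away₁) Ls
                          (λ { _ (a , refl) → a , refl }) pLs)
         (All-dupStep {P = _≡ right₁} {Right₂} (# 1) (right₁ ∷ []) ds
                      (λ { _ e refl → e , refl }) (refl ∷ []))))

spoiler-wins : SpoilerHasWinningStrategy 3 2 4 3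
spoiler-wins = inj₂ (# 0 , inj₂ (middle ∷ [] , λ ds →
  round₂ (All-dupStep {P = _≡ start} {Left₁} (# 0) (start ∷ []) ds
                      (λ { _ a refl → a , refl }) (refl ∷ []))))

proposition5p6 :
    (¬ Σ Formula (λ φ → IsSentence φ × qcount φ ≤ 3 × Separating-LO4-LO3 φ))
    × SpoilerHasWinningStrategy 3 2 4 3
proposition5p6 = no-separating-sentence , spoiler-wins
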